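{- Let $\mathcal{L}=(L,\leq)$ be a finite congruence-uniform lattice and let $x\in L$. Then $\Gamma(x)=\Psi(x)$ if and only if the interval $[x_{\downarrow},x]$ is isomorphic to the Boolean lattice $\mathrm{Bool}(k)$, where $k=|\Gamma(x)|$.
   Context: For a finite lattice $\mathcal{L}=(L,\leq)$, $\mathcal{J}(\mathcal{L})$ denotes the set of join-irreducible elements; each $j\in\mathcal{J}(\mathcal{L})$ has a unique lower cover $j_*$. For a cover relation $u\lessdot v$, $\mathrm{cg}(u,v)$ is the finest lattice congruence in which $u,v$ are equivalent, and $\mathrm{cg}(j)=\mathrm{cg}(j_*,j)$; the join-irreducible elements of the congruence lattice are exactly the $\mathrm{cg}(j)$. A finite lattice is congruence-uniform if $j\mapsto\mathrm{cg}(j)$ is a bijection from $\mathcal{J}(\mathcal{L})$ onto the join-irreducible congruences, for both $\mathcal{L}$ and its dual. For a cover $u\lessdot v$, $j_{\mathrm{cg}(u,v)}$ denotes the unique $j\in\mathcal{J}(\mathcal{L})$ with $\mathrm{cg}(j)=\mathrm{cg}(u,v)$. The nucleus of $x$ is $x_\downarrow=\bigwedge\{y\mid y\lessdot x\}$ (take $x_\downarrow=\hat0$ for $x=\hat0$); the core label set is $\Psi(x)=\{j_{\mathrm{cg}(u,v)}\mid x_\downarrow\le u\lessdot v\le x\}$. $\Gamma(x)$ is the canonical join representation of $x$: a set $X$ with $\bigvee X=x$, irredundant (no proper subset has join $x$), and refining every other irredundant join representation $X'$ of $x$ (every element of $X$ lies below some element of $X'$); congruence-uniform lattices have canonical join representations.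 $\mathrm{Bool}(k)=(\wp(\{1,\dots,k\}),\subseteq)$. -}

module Defs where

open import Level using (0ℓ)
open import Data.Nat using (ℕ)
open import Data.Fin using (Fin; _≟_)
open import Data.Fin.Subset using (Subset; _∈_; _⊆_; _⊂_)
open import Data.Bool using (Bool; T)
open import Data.Product using (Σ; _×_; _,_)
open import Data.Sum using (_⊎_)
open import Function using (flip)
open import Function.Bundles using (_⇔_)
open import Relation.Nullary using (¬_)
open import Relation.Nullary.Decidable using (⌊_⌋)
open import Relation.Binary using (Rel; IsPartialOrder)
open import Relation.Binary.PropositionalEquality using (_≡_; _≢_; sym)
open import Relation.Binary.Lattice using (IsBoundedLattice; IsLattice)

-- A finite lattice: carrier Fin n, with equality _≡_.
-- (Every finite nonempty lattice is bounded; the bounds are included as data.)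

record FiniteLattice : Set₁ where
  field
    n   : ℕ
    _≤_ : Rel (Fin n) 0ℓ
    _∨_ : Fin n → Fin n → Fin n
    _∧_ : Fin n → Fin n → Fin n
    ⊤   : Fin n
    ⊥   : Fin n
    isBoundedLattice : IsBoundedLattice _≡_ _≤_ _∨_ _∧_ ⊤ ⊥

  Carrier : Set
  Carrier = Fin n

dual : FiniteLattice → FiniteLattice
dual L = record
  { n = n
  ; _≤_ = flip _≤_
  ; _∨_ = _∧_
  ; _∧_ = _∨_
  ; ⊤ = ⊥
  ; ⊥ = ⊤
  ; isBoundedLattice = record
      { isLattice = record
          { isPartialOrder = record
              { isPreorder = record
                  { isEquivalence = isEquivalence
                  ; reflexive = λ eq → reflexive (sym eq)
                  ; trans = λ p q → trans q p
                  }
              ; antisym = λ p q → antisym q p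
              }
          ; supremum = infimum
          ; infimum = supremum
          }
      ; maximum = minimum
      ; minimum = maximum
      }
  }
  where
  open FiniteLattice L
  open IsBoundedLattice isBoundedLattice

module _ (L : FiniteLattice) where
  open FiniteLattice L

  _<_ : Carrier → Carrier → Set
  a < b = a ≤ b × a ≢ b

  _⋖_ : Carrier → Carrier → Set
  u ⋖ v = u < v × (∀ z → u < z → ¬ (z < v))

  IsJoinIrreducible : Carrier → Set
  IsJoinIrreducible j = j ≢ ⊥ × (∀ a b → a ∨ b ≡ j → a ≡ j ⊎ b ≡ j)

  BRel : Set
  BRel = Carrier → Carrier → Bool

  record IsCongruence (θ : BRel) : Set where
    field
      refl′  : ∀ a → T (θ a a)
      sym′   : ∀ a b → T (θ a b) → T (θ b a)
      trans′ : ∀ a b c → T (θ a b) → T (θ b c) → T (θ a c)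
      ∨-compat : ∀ a b c → T (θ a b) → T (θ (a ∨ c) (b ∨ c))
      ∧-compat : ∀ a b c → T (θ a b) → T (θ (a ∧ c) (b ∧ c))

  _⊆ᶜ_ : BRel → BRel → Set
  θ ⊆ᶜ φ = ∀ a b → T (θ a b) → T (φ a b)

  _≐_ : BRel → BRel → Set
  θ ≐ φ = ∀ a b → T (θ a b) ⇔ T (φ a b)

  Δ : BRel
  Δ a b = ⌊ a ≟ b ⌋

  IsJoinInCon : BRel → BRel → BRel → Set
  IsJoinInCon θ α β =
    α ⊆ᶜ θ × β ⊆ᶜ θ × (∀ γ → IsCongruence γ → α ⊆ᶜ γ → β ⊆ᶜ γ → θ ⊆ᶜ γ)

  IsJoinIrreducibleCongruence : BRel → Set
  IsJoinIrreducibleCongruence θ =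
    IsCongruence θ × ¬ (θ ≐ Δ) ×
    (∀ α β → IsCongruence α → IsCongruence β → IsJoinInCon θ α β →
       θ ≐ α ⊎ θ ≐ β)

  cg : Carrier → Carrier → Rel Carrier 0ℓ
  cg u v a b = ∀ θ → IsCongruence θ → T (θ u v) → T (θ a b)

  -- cg(j) = cg(j_*, j), where j_* is the (unique, for j join-irreducible)
  -- lower cover of j
  cgJ : Carrier → Rel Carrier 0ℓ
  cgJ j a b = Σ Carrier λ j* → j* ⋖ j × cg j* j a b

  CgBijection : Set
  CgBijection =
    (∀ j → IsJoinIrreducible j →
       Σ BRel λ θ → IsJoinIrreducibleCongruence θ × (∀ a b → T (θ a b) ⇔ cgJ j a b))
    × (∀ j j′ → IsJoinIrreducible j → IsJoinIrreducible j′ →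
       (∀ a b → cgJ j a b ⇔ cgJ j′ a b) → j ≡ j′)
    × (∀ θ → IsJoinIrreducibleCongruence θ →
       Σ Carrier λ j → IsJoinIrreducible j × (∀ a b → T (θ a b) ⇔ cgJ j a b))

  -- nucleus: x_↓ = ⋀{y | y ⋖ x}, and x_↓ = ⊥ when x = ⊥
  IsNucleus : Carrier → Carrier → Set
  IsNucleus x z =
    (x ≡ ⊥ → z ≡ ⊥) ×
    (x ≢ ⊥ → (∀ y → y ⋖ x → z ≤ y) × (∀ w → (∀ y → y ⋖ x → w ≤ y) → w ≤ z))

  InΨ : Carrier → Carrier → Carrier → Set
  InΨ x xd j = IsJoinIrreducible j ×
    Σ Carrier λ u → Σ Carrier λ v →
      xd ≤ u × u ⋖ v × v ≤ x × (∀ a b → cgJ j a b ⇔ cg u v a b)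

  IsJoinOf : Subset n → Carrier → Set
  IsJoinOf X x = (∀ y → y ∈ X → y ≤ x) × (∀ z → (∀ y → y ∈ X → y ≤ z) → x ≤ z)

  IsIrredundantJoinRep : Subset n → Carrier → Set
  IsIrredundantJoinRep X x = IsJoinOf X x × (∀ Y → Y ⊂ X → ¬ IsJoinOf Y x)

  IsCanonicalJoinRep : Carrier → Subset n → Set
  IsCanonicalJoinRep x X = IsIrredundantJoinRep X x ×
    (∀ X′ → IsIrredundantJoinRep X′ x →
       ∀ y → y ∈ X → Σ Carrier λ y′ → y′ ∈ X′ × y ≤ y′)

  record IntervalIsoBool (a b : Carrier) (k : ℕ) : Set where
    field
      f : Carrier → Subset k
      g : Subset k → Carrier
      g-in : ∀ s → a ≤ g s × g s ≤ b
      g∘f : ∀ y → a ≤ y → y ≤ b → g (f y) ≡ y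
      f∘g : ∀ s → f (g s) ≡ s
      f-order : ∀ y z → a ≤ y → y ≤ b → a ≤ z → z ≤ b → (y ≤ z ⇔ f y ⊆ f z)

CongruenceUniform : FiniteLattice → Set
CongruenceUniform L = CgBijection L × CgBijection (dual L)

-- A cover u ⋖ v is labelled by a minimal j with j ≤ v and j ≰ u: such a j is join-irreducible,
-- and its lower cover j_* ⋖ j transposes up to u ⋖ v, so cg(j) = cg(u,v). Each canonical
-- joinand j of x is the label of a lower cover y ⋖ x lying above the other joinands and above
-- x_↓, so Γ(x) ⊆ Ψ(x) always. If Ψ(x) ⊆ Γ(x), every y ∈ [x_↓, x] is x_↓ joined with the
-- canonical joinands below y (otherwise a cover u ⋖ y above that join would be labelled by an
-- element of Ψ(x) ⊆ Γ(x) below y but not below u), while no joinand lies below x_↓ joined with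
-- the others; so y ↦ {j ∈ Γ(x) | j ≤ y} is an isomorphism onto Bool(|Γ(x)|). Conversely, in a
-- Boolean interval every cover transposes to a lower cover of x, whose label is canonical, and
-- injectivity of j ↦ cg(j) identifies every element of Ψ(x) with such a label.

module Submission where

open import Defs hiding (_<_; _⋖_)
import Defs
open import Data.Fin.Subset using (Subset; _∈_; ∣_∣)
open import Function.Bundles using (_⇔_)

open import Level using (0ℓ)
open import Function using (_∘_)
open import Function.Bundles using (mk⇔; Equivalence)
open import Function.Properties.Equivalence using () renaming (sym to ⇔-sym; trans to ⇔-trans)
open import Data.Bool using (T)
open import Data.Bool.Properties using (T-≡)
open import Data.Fin using (Fin; zero; suc; _≟_)
open import Data.Fin.Properties using (any?; all?; suc-injective)
open import Data.Fin.Induction using (spo-wellFounded; spo-noetherian)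
open import Data.Fin.Subset
  using (_∉_; _⊆_; _∪_; _─_; _-_; ⁅_⁆; ∁; inside; outside) renaming (⊤ to Everything)
open import Data.Fin.Subset.Properties
  using (_∈?_; _⊆?_; _⊂?_; anySubset?; ⊆-refl; ⊆-trans; ⊆-antisym; p─q⊆p; x∈p⇒p-x⊂p;
         x∈p∧x≢y⇒x∈p-y; x∈p∪q⁺; x∈p∪q⁻; x∈⁅x⁆; x∈⁅y⁆⇒x≡y; x≢y⇒x∉⁅y⁆; x∈∁p⇒x∉p; x∉p⇒x∈∁p; ∈⊤)
open import Data.Fin.Subset.Induction using (⊂-wellFounded)
open import Data.Vec.Base using ([]; _∷_; here; there; tabulate)
open import Data.Vec.Properties using (lookup∘tabulate; []=⇒lookup; lookup⇒[]=)
open import Data.Product using (∃; _×_; _,_; proj₁; proj₂)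
open import Data.Sum using (_⊎_; inj₁; inj₂; [_,_]′)
open import Induction.WellFounded using (WellFounded; Acc; acc)
open import Relation.Nullary using (¬_; Dec; yes; no; contradiction)
open import Relation.Nullary.Decidable using (⌊_⌋; toWitness; fromWitness; _×-dec_; _→-dec_; ¬?)
open import Relation.Unary using (Pred; Decidable)
open import Relation.Binary using (Rel; IsStrictPartialOrder)
import Relation.Binary.Definitions as B
open import Relation.Binary.PropositionalEquality
  using (_≡_; _≢_; refl; sym; trans; cong; subst; subst₂)
open import Relation.Binary.Lattice using (Lattice; IsBoundedLattice)
import Relation.Binary.Construct.NonStrictToStrict as ToStrict
import Relation.Binary.Lattice.Properties.JoinSemilattice as JoinSemilatticeProperties
import Relation.Binary.Lattice.Properties.MeetSemilattice as MeetSemilatticeProperties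

module _ {a ℓ p} {A : Set a} {_⊏_ : Rel A ℓ} (⊏-wellFounded : WellFounded _⊏_)
         {P : Pred A p} (smaller? : ∀ x → Dec (∃ λ z → P z × z ⊏ x)) where

  ∃-minimal : ∀ {x} → P x → ∃ λ m → P m × (∀ {z} → P z → ¬ z ⊏ m)
  ∃-minimal {x} = go (⊏-wellFounded x)
    where
    go : ∀ {x} → Acc _⊏_ x → P x → ∃ λ m → P m × (∀ {z} → P z → ¬ z ⊏ m)
    go {x} (acc rs) px with smaller? x
    ... | yes (z , pz , z⊏x) = go (rs z⊏x) pz
    ... | no ∄smaller = x , px , λ pz z⊏x → ∄smaller (_ , pz , z⊏x)

x∈p─q⇒x∉q : ∀ {n} {p q : Subset n} {x} → x ∈ p ─ q → x ∉ q
x∈p─q⇒x∉q {p = _ ∷ p} {inside ∷ q} (there x∈p─q) (there x∈q) = x∈p─q⇒x∉q x∈p─q x∈q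
x∈p─q⇒x∉q {p = _ ∷ p} {outside ∷ q} (there x∈p─q) (there x∈q) = x∈p─q⇒x∉q x∈p─q x∈q

x∈p-y⇒x≢y : ∀ {n} {p : Subset n} {x y} → x ∈ p - y → x ≢ y
x∈p-y⇒x≢y x∈p-y refl = x∈p─q⇒x∉q x∈p-y (x∈⁅x⁆ _)

module _ {n p} {P : Pred (Fin n) p} (P? : Decidable P) where

  fromPred : Subset n
  fromPred = tabulate (⌊_⌋ ∘ P?)

  ∈-fromPred⁺ : ∀ {i} → P i → i ∈ fromPred
  ∈-fromPred⁺ {i} pi = lookup⇒[]= i fromPred
    (trans (lookup∘tabulate (⌊_⌋ ∘ P?) i) (Equivalence.to T-≡ (fromWitness pi)))

  ∈-fromPred⁻ : ∀ {i} → i ∈ fromPred → P i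
  ∈-fromPred⁻ {i} i∈ = toWitness
    (Equivalence.from T-≡ (trans (sym (lookup∘tabulate (⌊_⌋ ∘ P?) i)) ([]=⇒lookup i∈)))

record Enumeration {n} (X : Subset n) : Set where
  field
    elem            : Fin ∣ X ∣ → Fin n
    elem-∈          : ∀ i → elem i ∈ X
    elem-injective  : ∀ {i i′} → elem i ≡ elem i′ → i ≡ i′
    elem-surjective : ∀ {j} → j ∈ X → ∃ λ i → elem i ≡ j

enumerate : ∀ {n} (X : Subset n) → Enumeration X
enumerate [] = record
  { elem = λ () ; elem-∈ = λ () ; elem-injective = λ { {()} } ; elem-surjective = λ () }
enumerate (inside ∷ X) = record
  { elem = elem′
  ; elem-∈ = elem′-∈
  ; elem-injective = elem′-injective
  ; elem-surjective = elem′-surjective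
  }
  where
  open Enumeration (enumerate X)
  elem′ : Fin ∣ inside ∷ X ∣ → Fin _
  elem′ zero    = zero
  elem′ (suc i) = suc (elem i)
  elem′-∈ : ∀ i → elem′ i ∈ inside ∷ X
  elem′-∈ zero    = here
  elem′-∈ (suc i) = there (elem-∈ i)
  elem′-injective : ∀ {i i′} → elem′ i ≡ elem′ i′ → i ≡ i′
  elem′-injective {zero}  {zero}   _ = refl
  elem′-injective {suc i} {suc i′} e = cong suc (elem-injective (suc-injective e))
  elem′-surjective : ∀ {j} → j ∈ inside ∷ X → ∃ λ i → elem′ i ≡ j
  elem′-surjective here = zero , refl
  elem′-surjective (there j∈X) with elem-surjective j∈X
  ... | i , refl = suc i , refl
enumerate (outside ∷ X) = record
  { elem = suc ∘ elem
  ; elem-∈ = there ∘ elem-∈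
  ; elem-injective = elem-injective ∘ suc-injective
  ; elem-surjective = λ { (there j∈X) → let i , e = elem-surjective j∈X in i , cong suc e }
  }
  where open Enumeration (enumerate X)

module _ (L : FiniteLattice) where
  open FiniteLattice L
  open IsBoundedLattice isBoundedLattice
    using (isPartialOrder; x≤x∨y; y≤x∨y; ∨-least; x∧y≤x; x∧y≤y; ∧-greatest; minimum)
    renaming (refl to ≤-refl; trans to ≤-trans; antisym to ≤-antisym)

  private
    lattice : Lattice 0ℓ 0ℓ 0ℓ
    lattice = record { isLattice = IsBoundedLattice.isLattice isBoundedLattice }

  open JoinSemilatticeProperties (Lattice.joinSemilattice lattice)
    using (x≤y⇒x∨y≈y; ≈-dec⇒≤-dec)
  open MeetSemilatticeProperties (Lattice.meetSemilattice lattice)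
    using (∧-comm; y≤x⇒x∧y≈y)

  infix 4 _<_ _⋖_ _≋_

  _<_ : Rel Carrier 0ℓ
  _<_ = Defs._<_ L

  _⋖_ : Rel Carrier 0ℓ
  _⋖_ = Defs._⋖_ L

  _≋_ : Rel Carrier 0ℓ → Rel Carrier 0ℓ → Set
  R ≋ S = ∀ a b → R a b ⇔ S a b

  ≋-sym : ∀ {R S} → R ≋ S → S ≋ R
  ≋-sym R≋S a b = ⇔-sym (R≋S a b)

  ≋-trans : ∀ {R S U} → R ≋ S → S ≋ U → R ≋ U
  ≋-trans R≋S S≋U a b = ⇔-trans (R≋S a b) (S≋U a b)

  _≤?_ : B.Decidable _≤_
  _≤?_ = ≈-dec⇒≤-dec _≟_

  _<?_ : B.Decidable _<_
  _<?_ = ToStrict.<-decidable _≡_ _≤_ _≟_ _≤?_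

  <-isStrictPartialOrder : IsStrictPartialOrder _≡_ _<_
  <-isStrictPartialOrder = ToStrict.<-isStrictPartialOrder _≡_ _≤_ isPartialOrder

  ∃-minimalElement : ∀ {P : Pred Carrier 0ℓ} → Decidable P → ∀ {a} → P a →
                     ∃ λ m → P m × (∀ {z} → P z → ¬ z < m)
  ∃-minimalElement P? = ∃-minimal (spo-wellFounded <-isStrictPartialOrder)
                                 (λ a → any? λ z → P? z ×-dec z <? a)

  ∃-maximalElement : ∀ {P : Pred Carrier 0ℓ} → Decidable P → ∀ {a} → P a →
                     ∃ λ m → P m × (∀ {z} → P z → ¬ m < z)
  ∃-maximalElement P? = ∃-minimal (spo-noetherian <-isStrictPartialOrder)
                                 (λ a → any? λ z → P? z ×-dec a <? z)

  ⋖-between : ∀ {u v w} → u ⋖ v → u ≤ w → w ≤ v → w ≡ u ⊎ w ≡ v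
  ⋖-between {u} {v} {w} (_ , nothing-between) u≤w w≤v with w ≟ u | w ≟ v
  ... | yes w≡u | _       = inj₁ w≡u
  ... | no _    | yes w≡v = inj₂ w≡v
  ... | no w≢u  | no w≢v  = contradiction (w≤v , w≢v) (nothing-between w (u≤w , w≢u ∘ sym))

  ∃-cover-below : ∀ {a b} → a < b → ∃ λ c → a ≤ c × c ⋖ b
  ∃-cover-below {a} {b} a<b
    with ∃-maximalElement (λ c → (a ≤? c) ×-dec (c <? b)) (≤-refl , a<b)
  ... | c , (a≤c , c<b) , maximal =
    c , a≤c , c<b , λ z c<z z<b → maximal (≤-trans a≤c (proj₁ c<z) , z<b) c<z

  ⋖⇒< : ∀ {u v} → u ⋖ v → u < v
  ⋖⇒< = proj₁

  ⋖⇒≤ : ∀ {u v} → u ⋖ v → u ≤ v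
  ⋖⇒≤ = proj₁ ∘ ⋖⇒<

  <⇒≱ : ∀ {a b} → a < b → ¬ b ≤ a
  <⇒≱ (a≤b , a≢b) b≤a = a≢b (≤-antisym a≤b b≤a)

  join-of-cover : ∀ {y x j} → y ⋖ x → j ≤ x → ¬ j ≤ y → j ∨ y ≡ x
  join-of-cover {y} {x} {j} y⋖x j≤x j≰y
    with ⋖-between y⋖x (y≤x∨y j y) (∨-least j≤x (⋖⇒≤ y⋖x))
  ... | inj₁ j∨y≡y = contradiction (subst (j ≤_) j∨y≡y (x≤x∨y j y)) j≰y
  ... | inj₂ j∨y≡x = j∨y≡x

  meet-of-cover : ∀ {u v y} → u ⋖ v → u ≤ y → ¬ v ≤ y → v ∧ y ≡ u
  meet-of-cover {u} {v} {y} u⋖v u≤y v≰y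
    with ⋖-between u⋖v (∧-greatest (⋖⇒≤ u⋖v) u≤y) (x∧y≤x v y)
  ... | inj₁ v∧y≡u = v∧y≡u
  ... | inj₂ v∧y≡v = contradiction (subst (_≤ y) v∧y≡v (x∧y≤y v y)) v≰y

  JoinIrreducible : Carrier → Set
  JoinIrreducible = IsJoinIrreducible L

  ∃-lowerCover : ∀ {j} → JoinIrreducible j → ∃ λ c → c ⋖ j
  ∃-lowerCover (j≢⊥ , _) =
    let c , _ , c⋖j = ∃-cover-below (minimum _ , j≢⊥ ∘ sym) in c , c⋖j

  below-lowerCover : ∀ {j c z} → JoinIrreducible j → c ⋖ j → z < j → z ≤ c
  below-lowerCover {j} {c} {z} (_ , irreducible) c⋖j (z≤j , z≢j)
    with ⋖-between c⋖j (y≤x∨y z c) (∨-least z≤j (⋖⇒≤ c⋖j))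
  ... | inj₁ z∨c≡c = subst (z ≤_) z∨c≡c (x≤x∨y z c)
  ... | inj₂ z∨c≡j with irreducible z c z∨c≡j
  ...   | inj₁ z≡j = contradiction z≡j z≢j
  ...   | inj₂ c≡j = contradiction c≡j (proj₂ (⋖⇒< c⋖j))

  lowerCover-unique : ∀ {j c c′} → JoinIrreducible j → c ⋖ j → c′ ⋖ j → c ≡ c′
  lowerCover-unique ji c⋖j c′⋖j =
    ≤-antisym (below-lowerCover ji c′⋖j (⋖⇒< c⋖j)) (below-lowerCover ji c⋖j (⋖⇒< c′⋖j))

  lower≤⇒joinIrreducible : ∀ {j u} → ¬ j ≤ u → (∀ {z} → z < j → z ≤ u) →
                                   JoinIrreducible j
  lower≤⇒joinIrreducible {j} {u} j≰u lower≤u = j≢⊥ , irreducible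
    where
    j≢⊥ : j ≢ ⊥
    j≢⊥ refl = j≰u (minimum u)
    irreducible : ∀ a b → a ∨ b ≡ j → a ≡ j ⊎ b ≡ j
    irreducible a b a∨b≡j with a ≟ j | b ≟ j
    ... | yes a≡j | _       = inj₁ a≡j
    ... | no _    | yes b≡j = inj₂ b≡j
    ... | no a≢j  | no b≢j  = contradiction (subst (_≤ u) a∨b≡j (∨-least a≤u b≤u)) j≰u
      where
      a≤u : a ≤ u
      a≤u = lower≤u (subst (a ≤_) a∨b≡j (x≤x∨y a b) , a≢j)
      b≤u : b ≤ u
      b≤u = lower≤u (subst (b ≤_) a∨b≡j (y≤x∨y a b) , b≢j)

  transpose-collapses : ∀ {θ u v y x} → IsCongruence L θ → v ∨ y ≡ x → v ∧ y ≡ u →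
                        T (θ u v) ⇔ T (θ y x)
  transpose-collapses {θ} {u} {v} {y} {x} θ-cong v∨y≡x v∧y≡u = mk⇔
    (λ θuv → subst₂ (λ a b → T (θ a b)) u∨y≡y v∨y≡x (∨-compat u v y θuv))
    (λ θyx → subst₂ (λ a b → T (θ a b)) y∧v≡u x∧v≡v (∧-compat y x v θyx))
    where
    open IsCongruence θ-cong
    u∨y≡y : u ∨ y ≡ y
    u∨y≡y = x≤y⇒x∨y≈y (subst (_≤ y) v∧y≡u (x∧y≤y v y))
    y∧v≡u : y ∧ v ≡ u
    y∧v≡u = trans (∧-comm y v) v∧y≡u
    x∧v≡v : x ∧ v ≡ v
    x∧v≡v = y≤x⇒x∧y≈y (subst (v ≤_) v∨y≡x (x≤x∨y v y))

  cg-transpose : ∀ {u v y x} → v ∨ y ≡ x → v ∧ y ≡ u → cg L u v ≋ cg L y x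
  cg-transpose {u} {v} {y} {x} v∨y≡x v∧y≡u a b = mk⇔
    (λ θuv⇒θab θ θ-cong → θuv⇒θab θ θ-cong ∘ Equivalence.from (collapses θ-cong))
    (λ θyx⇒θab θ θ-cong → θyx⇒θab θ θ-cong ∘ Equivalence.to (collapses θ-cong))
    where
    collapses : ∀ {θ} → IsCongruence L θ → T (θ u v) ⇔ T (θ y x)
    collapses θ-cong = transpose-collapses θ-cong v∨y≡x v∧y≡u

  cg-cover-transpose : ∀ {u v y x} → u ⋖ v → y ⋖ x → v ≤ x → u ≤ y → ¬ v ≤ y →
                       cg L u v ≋ cg L y x
  cg-cover-transpose u⋖v y⋖x v≤x u≤y v≰y =
    cg-transpose (join-of-cover y⋖x v≤x v≰y) (meet-of-cover u⋖v u≤y v≰y)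

  cgJ≋cg-lowerCover : ∀ {j c} → JoinIrreducible j → c ⋖ j → cgJ L j ≋ cg L c j
  cgJ≋cg-lowerCover {j} ji c⋖j a b = mk⇔
    (λ { (c′ , c′⋖j , cg-c′j) → subst (λ c → cg L c j a b) (lowerCover-unique ji c′⋖j c⋖j) cg-c′j })
    (λ cg-cj → _ , c⋖j , cg-cj)

  record IsLabel (u v j : Carrier) : Set where
    field
      j≤v   : j ≤ v
      j≰u   : ¬ j ≤ u
      <j⇒≤u : ∀ {z} → z < j → z ≤ u

  ∃-label : ∀ {u v} → u ⋖ v → ∃ (IsLabel u v)
  ∃-label {u} {v} u⋖v
    with ∃-minimalElement (λ z → (z ≤? v) ×-dec ¬? (z ≤? u)) (≤-refl , <⇒≱ (⋖⇒< u⋖v))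
  ... | j , (j≤v , j≰u) , minimal = j , record { j≤v = j≤v ; j≰u = j≰u ; <j⇒≤u = <j⇒≤u }
    where
    <j⇒≤u : ∀ {z} → z < j → z ≤ u
    <j⇒≤u {z} z<j with z ≤? u
    ... | yes z≤u = z≤u
    ... | no z≰u  = contradiction z<j (minimal (≤-trans (proj₁ z<j) j≤v , z≰u))

  module _ {u v j} (label : IsLabel u v j) where
    open IsLabel label

    label-joinIrreducible : JoinIrreducible j
    label-joinIrreducible = lower≤⇒joinIrreducible j≰u <j⇒≤u

    cgJ-label : u ⋖ v → cgJ L j ≋ cg L u v
    cgJ-label u⋖v =
      let c , c⋖j = ∃-lowerCover label-joinIrreducible in
      ≋-trans (cgJ≋cg-lowerCover label-joinIrreducible c⋖j)
              (cg-cover-transpose c⋖j u⋖v j≤v (<j⇒≤u (⋖⇒< c⋖j)) j≰u)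

  -- Join representations

  UpperBound : Subset n → Carrier → Set
  UpperBound Y z = ∀ y → y ∈ Y → y ≤ z

  upperBound? : ∀ Y z → Dec (UpperBound Y z)
  upperBound? Y z = all? λ y → (y ∈? Y) →-dec (y ≤? z)

  isJoinOf? : ∀ Y x → Dec (IsJoinOf L Y x)
  isJoinOf? Y x = upperBound? Y x ×-dec all? (λ z → upperBound? Y z →-dec (x ≤? z))

  ∪-upperBound : ∀ {Y Z z} → UpperBound Y z → UpperBound Z z → UpperBound (Y ∪ Z) z
  ∪-upperBound {Y} {Z} Y≤z Z≤z y y∈Y∪Z = [ Y≤z y , Z≤z y ]′ (x∈p∪q⁻ Y Z y∈Y∪Z)

  ⁅⁆-upperBound : ∀ {a z} → a ≤ z → UpperBound ⁅ a ⁆ z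
  ⁅⁆-upperBound a≤z y y∈⁅a⁆ = subst (_≤ _) (sym (x∈⁅y⁆⇒x≡y _ y∈⁅a⁆)) a≤z

  ∈-pair⁻ : ∀ {a b y : Carrier} → y ∈ ⁅ a ⁆ ∪ ⁅ b ⁆ → y ≡ a ⊎ y ≡ b
  ∈-pair⁻ {a} {b} y∈ with x∈p∪q⁻ ⁅ a ⁆ ⁅ b ⁆ y∈
  ... | inj₁ y∈⁅a⁆ = inj₁ (x∈⁅y⁆⇒x≡y a y∈⁅a⁆)
  ... | inj₂ y∈⁅b⁆ = inj₂ (x∈⁅y⁆⇒x≡y b y∈⁅b⁆)

  pair-isJoinOf : ∀ a b → IsJoinOf L (⁅ a ⁆ ∪ ⁅ b ⁆) (a ∨ b)
  pair-isJoinOf a b =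
    ∪-upperBound (⁅⁆-upperBound (x≤x∨y a b)) (⁅⁆-upperBound (y≤x∨y a b)) ,
    λ z pair≤z → ∨-least (pair≤z a (x∈p∪q⁺ (inj₁ (x∈⁅x⁆ a))))
                         (pair≤z b (x∈p∪q⁺ (inj₂ (x∈⁅x⁆ b))))

  ∃-irredundantSubrep : ∀ {Y x} → IsJoinOf L Y x →
                        ∃ λ Z → Z ⊆ Y × IsIrredundantJoinRep L Z x
  ∃-irredundantSubrep {Y} {x} Y-join
    with ∃-minimal ⊂-wellFounded
           (λ Z → anySubset? λ Z′ → ((Z′ ⊆? Y) ×-dec isJoinOf? Z′ x) ×-dec (Z′ ⊂? Z))
           (⊆-refl , Y-join)
  ... | Z , (Z⊆Y , Z-join) , minimal =
    Z , Z⊆Y , Z-join , λ Z′ Z′⊂Z Z′-join → minimal (⊆-trans (proj₁ Z′⊂Z) Z⊆Y , Z′-join) Z′⊂Z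

  ∃-lowerCover-above : ∀ {Y x} → UpperBound Y x → ¬ IsJoinOf L Y x →
                       ∃ λ y → y ⋖ x × UpperBound Y y
  ∃-lowerCover-above {Y} {x} Y≤x not-join
    with any? (λ z → upperBound? Y z ×-dec ¬? (x ≤? z))
  ... | no ∄z = contradiction (Y≤x , least) not-join
    where
    least : ∀ z → UpperBound Y z → x ≤ z
    least z Y≤z with x ≤? z
    ... | yes x≤z = x≤z
    ... | no x≰z  = contradiction (z , Y≤z , x≰z) ∄z
  ... | yes (z , Y≤z , x≰z) =
    let y , z∧x≤y , y⋖x = ∃-cover-below (x∧y≤y z x , x≰z ∘ z∧x≡x⇒x≤z) in
    y , y⋖x , λ i i∈Y → ≤-trans (∧-greatest (Y≤z i i∈Y) (Y≤x i i∈Y)) z∧x≤y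
    where
    z∧x≡x⇒x≤z : z ∧ x ≡ x → x ≤ z
    z∧x≡x⇒x≤z z∧x≡x = subst (_≤ z) z∧x≡x (x∧y≤x z x)

  module _ {x X} (canonical : IsCanonicalJoinRep L x X) where
    private
      X-join : IsJoinOf L X x
      X-join = proj₁ (proj₁ canonical)

    canonical-≤ : ∀ {j} → j ∈ X → j ≤ x
    canonical-≤ = proj₁ X-join _

    canonical-refines : ∀ {Y} → IsJoinOf L Y x → ∀ {j} → j ∈ X → ∃ λ y → y ∈ Y × j ≤ y
    canonical-refines Y-join {j} j∈X =
      let Z , Z⊆Y , Z-irredundant = ∃-irredundantSubrep Y-join
          y , y∈Z , j≤y = proj₂ canonical Z Z-irredundant j j∈X
      in y , Z⊆Y y∈Z , j≤y

    canonical-least : ∀ {j z} → UpperBound (X - j) z → j ≤ z → x ≤ z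
    canonical-least {j} {z} rest≤z j≤z = proj₂ X-join z X≤z
      where
      X≤z : UpperBound X z
      X≤z i i∈X with i ≟ j
      ... | yes refl = j≤z
      ... | no i≢j   = rest≤z i (x∈p∧x≢y⇒x∈p-y i∈X i≢j)

    rest-≤ : ∀ {j} → UpperBound (X - j) x
    rest-≤ {j} i i∈X-j = canonical-≤ (p─q⊆p X ⁅ j ⁆ i∈X-j)

    canonical-essential : ∀ {j} → j ∈ X → ¬ (∀ {z} → UpperBound (X - j) z → j ≤ z)
    canonical-essential {j} j∈X j≤bounds =
      proj₂ (proj₁ canonical) (X - j) (x∈p⇒p-x⊂p j∈X)
        (rest-≤ , λ z rest≤z → canonical-least rest≤z (j≤bounds rest≤z))

    canonical-incomparable : ∀ {i j} → j ∈ X → i ∈ X → i ≢ j → ¬ j ≤ i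
    canonical-incomparable j∈X i∈X i≢j j≤i =
      canonical-essential j∈X λ {z} rest≤z → ≤-trans j≤i (rest≤z _ (x∈p∧x≢y⇒x∈p-y i∈X i≢j))

    canonical-exchange : ∀ {j Z} → j ∈ X → IsJoinOf L ((X - j) ∪ Z) x → ∃ λ z → z ∈ Z × j ≤ z
    canonical-exchange {j} {Z} j∈X exchanged-join with canonical-refines exchanged-join j∈X
    ... | y , y∈ , j≤y with x∈p∪q⁻ (X - j) Z y∈
    ...   | inj₂ y∈Z   = y , y∈Z , j≤y
    ...   | inj₁ y∈X-j = contradiction j≤y
      (canonical-incomparable j∈X (p─q⊆p X ⁅ j ⁆ y∈X-j) (x∈p-y⇒x≢y y∈X-j))

    canonical-joinIrreducible : ∀ {j} → j ∈ X → JoinIrreducible j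
    canonical-joinIrreducible {j} j∈X = j≢⊥ , irreducible
      where
      j≢⊥ : j ≢ ⊥
      j≢⊥ refl = canonical-essential j∈X (λ {z} _ → minimum z)
      irreducible : ∀ a b → a ∨ b ≡ j → a ≡ j ⊎ b ≡ j
      irreducible a b a∨b≡j with canonical-exchange j∈X exchanged-join
        where
        pair-join : IsJoinOf L (⁅ a ⁆ ∪ ⁅ b ⁆) j
        pair-join = subst (IsJoinOf L _) a∨b≡j (pair-isJoinOf a b)
        exchanged-join : IsJoinOf L ((X - j) ∪ (⁅ a ⁆ ∪ ⁅ b ⁆)) x
        exchanged-join =
          ∪-upperBound rest-≤ (λ y y∈ → ≤-trans (proj₁ pair-join y y∈) (canonical-≤ j∈X)) ,
          λ z bounds → canonical-least (λ y y∈ → bounds y (x∈p∪q⁺ (inj₁ y∈)))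
                                       (proj₂ pair-join z λ y y∈ → bounds y (x∈p∪q⁺ (inj₂ y∈)))
      ... | y , y∈pair , j≤y with ∈-pair⁻ y∈pair
      ...   | inj₁ refl = inj₁ (≤-antisym (subst (y ≤_) a∨b≡j (x≤x∨y a b)) j≤y)
      ...   | inj₂ refl = inj₂ (≤-antisym (subst (y ≤_) a∨b≡j (y≤x∨y a b)) j≤y)

    ∃-lowerCover-avoiding : ∀ {j c} → j ∈ X → c ⋖ j →
      ∃ λ y → y ⋖ x × c ≤ y × ¬ j ≤ y × UpperBound (X - j) y
    ∃-lowerCover-avoiding {j} {c} j∈X c⋖j
      with ∃-lowerCover-above (∪-upperBound rest-≤ (⁅⁆-upperBound c≤x)) not-join
      where
      c≤x : c ≤ x
      c≤x = ≤-trans (⋖⇒≤ c⋖j) (canonical-≤ j∈X)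
      not-join : ¬ IsJoinOf L ((X - j) ∪ ⁅ c ⁆) x
      not-join exchanged-join with canonical-exchange j∈X exchanged-join
      ... | z , z∈⁅c⁆ , j≤z =
        <⇒≱ (⋖⇒< c⋖j) (subst (j ≤_) (x∈⁅y⁆⇒x≡y c z∈⁅c⁆) j≤z)
    ... | y , y⋖x , bounds = y , y⋖x , c≤y , j≰y , rest≤y
      where
      rest≤y : UpperBound (X - j) y
      rest≤y i i∈ = bounds i (x∈p∪q⁺ (inj₁ i∈))
      c≤y : c ≤ y
      c≤y = bounds c (x∈p∪q⁺ (inj₂ (x∈⁅x⁆ c)))
      j≰y : ¬ j ≤ y
      j≰y = <⇒≱ (⋖⇒< y⋖x) ∘ canonical-least rest≤y

    lowerCover-label∈canonical : ∀ {y j} → y ⋖ x → IsLabel y x j → j ∈ X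
    lowerCover-label∈canonical {y} {j} y⋖x label
      with any? (λ i → (i ∈? X) ×-dec ¬? (i ≤? y))
    ... | no ∄i = contradiction (proj₂ X-join y X≤y) (<⇒≱ (⋖⇒< y⋖x))
      where
      X≤y : UpperBound X y
      X≤y i i∈X with i ≤? y
      ... | yes i≤y = i≤y
      ... | no i≰y  = contradiction (i , i∈X , i≰y) ∄i
    ... | yes (i , i∈X , i≰y) with canonical-refines pair-join i∈X
      where
      pair-join : IsJoinOf L (⁅ j ⁆ ∪ ⁅ y ⁆) x
      pair-join = subst (IsJoinOf L _) (join-of-cover y⋖x (IsLabel.j≤v label) (IsLabel.j≰u label))
                        (pair-isJoinOf j y)
    ... | z , z∈pair , i≤z with ∈-pair⁻ z∈pair
    ...   | inj₂ refl = contradiction i≤z i≰y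
    ...   | inj₁ refl with i ≟ z
    ...     | yes refl = i∈X
    ...     | no i≢z   = contradiction (IsLabel.<j⇒≤u label (i≤z , i≢z)) i≰y

  -- Boolean intervals

  ⋁ : ∀ {m} → (Fin m → Carrier) → Subset m → Carrier
  ⋁ e []            = ⊥
  ⋁ e (inside ∷ S)  = e zero ∨ ⋁ (e ∘ suc) S
  ⋁ e (outside ∷ S) = ⋁ (e ∘ suc) S

  ⋁-upper : ∀ {m} (e : Fin m → Carrier) {S i} → i ∈ S → e i ≤ ⋁ e S
  ⋁-upper e {inside ∷ S}  here        = x≤x∨y _ _
  ⋁-upper e {inside ∷ S}  (there i∈S) = ≤-trans (⋁-upper (e ∘ suc) i∈S) (y≤x∨y _ _)
  ⋁-upper e {outside ∷ S} (there i∈S) = ⋁-upper (e ∘ suc) i∈S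

  ⋁-least : ∀ {m} (e : Fin m → Carrier) {S z} → (∀ i → i ∈ S → e i ≤ z) → ⋁ e S ≤ z
  ⋁-least e {[]}          bounded = minimum _
  ⋁-least e {inside ∷ S}  bounded =
    ∨-least (bounded zero here) (⋁-least (e ∘ suc) λ i i∈S → bounded (suc i) (there i∈S))
  ⋁-least e {outside ∷ S} bounded = ⋁-least (e ∘ suc) λ i i∈S → bounded (suc i) (there i∈S)

  module _ {a b k} (iso : IntervalIsoBool L a b k) where
    open IntervalIsoBool iso

    private
      g-lower : ∀ S → a ≤ g S
      g-lower = proj₁ ∘ g-in

      g-upper : ∀ S → g S ≤ b
      g-upper = proj₂ ∘ g-in

      reflect : ∀ {y z} → a ≤ y → y ≤ b → a ≤ z → z ≤ b → f y ⊆ f z → y ≤ z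
      reflect a≤y y≤b a≤z z≤b = Equivalence.from (f-order _ _ a≤y y≤b a≤z z≤b)

      preserve : ∀ {y z} → a ≤ y → y ≤ b → a ≤ z → z ≤ b → y ≤ z → f y ⊆ f z
      preserve a≤y y≤b a≤z z≤b = Equivalence.to (f-order _ _ a≤y y≤b a≤z z≤b)

    f-top : ∀ i → i ∈ f b
    f-top i = preserve (g-lower _) (g-upper _) a≤b ≤-refl (g-upper Everything)
                       (subst (i ∈_) (sym (f∘g _)) ∈⊤)
      where
      a≤b : a ≤ b
      a≤b = ≤-trans (g-lower Everything) (g-upper Everything)

    ∈-f-coatom : ∀ {i l} → l ≢ i → l ∈ f (g (∁ ⁅ i ⁆))
    ∈-f-coatom l≢i = subst (_ ∈_) (sym (f∘g _)) (x∉p⇒x∈∁p (x≢y⇒x∉⁅y⁆ l≢i))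

    ∉-f-coatom : ∀ {i} → i ∉ f (g (∁ ⁅ i ⁆))
    ∉-f-coatom {i} i∈ = x∈∁p⇒x∉p (subst (i ∈_) (f∘g _) i∈) (x∈⁅x⁆ i)

    coatom : ∀ i → g (∁ ⁅ i ⁆) ⋖ b
    coatom i = (g-upper _ , y≢b) , nothing-between
      where
      y : Carrier
      y = g (∁ ⁅ i ⁆)
      y≢b : y ≢ b
      y≢b y≡b = ∉-f-coatom (subst (λ y → i ∈ f y) (sym y≡b) (f-top i))
      nothing-between : ∀ z → y < z → ¬ z < b
      nothing-between z (y≤z , y≢z) (z≤b , z≢b) with i ∈? f z
      ... | yes i∈fz = z≢b (≤-antisym z≤b (reflect a≤b ≤-refl a≤z z≤b fb⊆fz))
        where
        a≤z : a ≤ z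
        a≤z = ≤-trans (g-lower _) y≤z
        a≤b : a ≤ b
        a≤b = ≤-trans a≤z z≤b
        fb⊆fz : f b ⊆ f z
        fb⊆fz {l} _ with l ≟ i
        ... | yes refl = i∈fz
        ... | no l≢i   = preserve (g-lower _) (g-upper _) a≤z z≤b y≤z (∈-f-coatom l≢i)
      ... | no i∉fz = y≢z (≤-antisym y≤z (reflect a≤z z≤b (g-lower _) (g-upper _) fz⊆fy))
        where
        a≤z : a ≤ z
        a≤z = ≤-trans (g-lower _) y≤z
        fz⊆fy : f z ⊆ f y
        fz⊆fy {l} l∈fz = ∈-f-coatom λ { refl → i∉fz l∈fz }

    ∃-coatom-transpose : ∀ {u v} → a ≤ u → u ⋖ v → v ≤ b → ∃ λ y → y ⋖ b × u ≤ y × ¬ v ≤ y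
    ∃-coatom-transpose {u} {v} a≤u u⋖v v≤b with any? (λ i → (i ∈? f v) ×-dec ¬? (i ∈? f u))
    ... | no ∄i = contradiction (reflect a≤v v≤b a≤u u≤b fv⊆fu) (<⇒≱ (⋖⇒< u⋖v))
      where
      u≤b : u ≤ b
      u≤b = ≤-trans (⋖⇒≤ u⋖v) v≤b
      a≤v : a ≤ v
      a≤v = ≤-trans a≤u (⋖⇒≤ u⋖v)
      fv⊆fu : f v ⊆ f u
      fv⊆fu {i} i∈fv with i ∈? f u
      ... | yes i∈fu = i∈fu
      ... | no i∉fu  = contradiction (i , i∈fv , i∉fu) ∄i
    ... | yes (i , i∈fv , i∉fu) = g (∁ ⁅ i ⁆) , coatom i , u≤y , v≰y
      where
      u≤y : u ≤ g (∁ ⁅ i ⁆)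
      u≤y = reflect a≤u (≤-trans (⋖⇒≤ u⋖v) v≤b) (g-lower _) (g-upper _)
                    (λ l∈fu → ∈-f-coatom λ { refl → i∉fu l∈fu })
      v≰y : ¬ v ≤ g (∁ ⁅ i ⁆)
      v≰y v≤y = ∉-f-coatom (preserve (≤-trans a≤u (⋖⇒≤ u⋖v)) v≤b (g-lower _) (g-upper _) v≤y i∈fv)

  -- Core labels

  CgJInjective : Set
  CgJInjective = ∀ j j′ → JoinIrreducible j → JoinIrreducible j′ → cgJ L j ≋ cgJ L j′ → j ≡ j′

  module _ {x xd} (nucleus : IsNucleus L x xd) where

    nucleus-≤-lowerCover : ∀ {y} → y ⋖ x → xd ≤ y
    nucleus-≤-lowerCover {y} y⋖x = proj₁ (proj₂ nucleus x≢⊥) y y⋖x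
      where
      x≢⊥ : x ≢ ⊥
      x≢⊥ refl = <⇒≱ (⋖⇒< y⋖x) (minimum y)

    nucleus-≤ : xd ≤ x
    nucleus-≤ with x ≟ ⊥
    ... | yes x≡⊥ = subst (_≤ x) (sym (proj₁ nucleus x≡⊥)) (minimum x)
    ... | no x≢⊥  =
      let c , _ , c⋖x = ∃-cover-below (minimum x , x≢⊥ ∘ sym) in
      ≤-trans (nucleus-≤-lowerCover c⋖x) (⋖⇒≤ c⋖x)

    module _ {X} (canonical : IsCanonicalJoinRep L x X) where

      ∃-lowerCover-transposing : ∀ {j} → j ∈ X →
        ∃ λ y → y ⋖ x × xd ≤ y × ¬ j ≤ y × UpperBound (X - j) y × cgJ L j ≋ cg L y x
      ∃-lowerCover-transposing j∈X =
        let j-irreducible = canonical-joinIrreducible canonical j∈X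
            c , c⋖j = ∃-lowerCover j-irreducible
            y , y⋖x , c≤y , j≰y , rest≤y = ∃-lowerCover-avoiding canonical j∈X c⋖j
        in y , y⋖x , nucleus-≤-lowerCover y⋖x , j≰y , rest≤y ,
           ≋-trans (cgJ≋cg-lowerCover j-irreducible c⋖j)
                   (cg-cover-transpose c⋖j y⋖x (canonical-≤ canonical j∈X) c≤y j≰y)

      canonical⊆Ψ : ∀ {j} → j ∈ X → InΨ L x xd j
      canonical⊆Ψ j∈X =
        let y , y⋖x , xd≤y , _ , _ , cgJ≋cg-yx = ∃-lowerCover-transposing j∈X in
        canonical-joinIrreducible canonical j∈X , y , x , xd≤y , y⋖x , ≤-refl , cgJ≋cg-yx

      Boolean⇒Ψ⊆canonical : CgJInjective → ∀ {k} → IntervalIsoBool L xd x k →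
                             ∀ {j} → InΨ L x xd j → j ∈ X
      Boolean⇒Ψ⊆canonical cgJ-injective iso (j-irreducible , u , v , xd≤u , u⋖v , v≤x , cgJ≋cg-uv) =
        let y , y⋖x , u≤y , v≰y = ∃-coatom-transpose iso xd≤u u⋖v v≤x
            j′ , label = ∃-label y⋖x
            j≡j′ = cgJ-injective _ j′ j-irreducible (label-joinIrreducible label)
                     (≋-trans cgJ≋cg-uv (≋-trans (cg-cover-transpose u⋖v y⋖x v≤x u≤y v≰y)
                                                 (≋-sym (cgJ-label label y⋖x))))
        in subst (_∈ X) (sym j≡j′) (lowerCover-label∈canonical canonical y⋖x label)

      module _ (Ψ⊆X : ∀ {j} → InΨ L x xd j → j ∈ X) where

        Ψ⊆canonical⇒generated : ∀ {y z} → xd ≤ z → z ≤ y → y ≤ x →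
                                (∀ {j} → j ∈ X → j ≤ y → j ≤ z) → z ≡ y
        Ψ⊆canonical⇒generated {y} {z} xd≤z z≤y y≤x X↓y≤z with z ≟ y
        ... | yes z≡y = z≡y
        ... | no z≢y  =
          let u , z≤u , u⋖y = ∃-cover-below (z≤y , z≢y)
              j , label = ∃-label u⋖y
              j∈X = Ψ⊆X (label-joinIrreducible label , u , y , ≤-trans xd≤z z≤u , u⋖y , y≤x ,
                         cgJ-label label u⋖y)
          in contradiction (≤-trans (X↓y≤z j∈X (IsLabel.j≤v label)) z≤u) (IsLabel.j≰u label)

        open Enumeration (enumerate X)

        private
          F : Carrier → Subset ∣ X ∣
          F z = fromPred (λ i → elem i ≤? z)

          ∈F⁺ : ∀ {z i} → elem i ≤ z → i ∈ F z
          ∈F⁺ {z} = ∈-fromPred⁺ (λ i → elem i ≤? z)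

          ∈F⁻ : ∀ {z i} → i ∈ F z → elem i ≤ z
          ∈F⁻ {z} = ∈-fromPred⁻ (λ i → elem i ≤? z)

          G : Subset ∣ X ∣ → Carrier
          G S = xd ∨ ⋁ elem S

          G-in : ∀ S → xd ≤ G S × G S ≤ x
          G-in S = x≤x∨y _ _ ,
                   ∨-least nucleus-≤ (⋁-least elem {S} λ i _ → canonical-≤ canonical (elem-∈ i))

          G-mono : ∀ {S S′} → S ⊆ S′ → G S ≤ G S′
          G-mono {S} S⊆S′ = ∨-least (x≤x∨y _ _)
            (≤-trans (⋁-least elem {S} λ i i∈S → ⋁-upper elem (S⊆S′ i∈S)) (y≤x∨y _ _))

          G∘F : ∀ y → xd ≤ y → y ≤ x → G (F y) ≡ y
          G∘F y xd≤y y≤x = Ψ⊆canonical⇒generated (x≤x∨y _ _)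
            (∨-least xd≤y (⋁-least elem {F y} λ i i∈Fy → ∈F⁻ i∈Fy)) y≤x
            λ j∈X j≤y → let i , elem-i≡j = elem-surjective j∈X in
              subst (_≤ G (F y)) elem-i≡j
                (≤-trans (⋁-upper elem (∈F⁺ (subst (_≤ y) (sym elem-i≡j) j≤y))) (y≤x∨y _ _))

          F∘G : ∀ S → F (G S) ≡ S
          F∘G S = ⊆-antisym FGS⊆S (λ i∈S → ∈F⁺ (≤-trans (⋁-upper elem i∈S) (y≤x∨y _ _)))
            where
            FGS⊆S : F (G S) ⊆ S
            FGS⊆S {i} i∈FGS with i ∈? S
            ... | yes i∈S = i∈S
            ... | no i∉S  =
              let y , _ , xd≤y , i≰y , rest≤y , _ = ∃-lowerCover-transposing (elem-∈ i)
                  S≤y : ∀ l → l ∈ S → elem l ≤ y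
                  S≤y l l∈S = rest≤y _ (x∈p∧x≢y⇒x∈p-y (elem-∈ l)
                                          λ e → i∉S (subst (_∈ S) (elem-injective e) l∈S))
              in contradiction (≤-trans (∈F⁻ i∈FGS) (∨-least xd≤y (⋁-least elem S≤y))) i≰y

          F-order : ∀ y z → xd ≤ y → y ≤ x → xd ≤ z → z ≤ x → (y ≤ z ⇔ F y ⊆ F z)
          F-order y z xd≤y y≤x xd≤z z≤x = mk⇔
            (λ y≤z {i} i∈Fy → ∈F⁺ (≤-trans (∈F⁻ i∈Fy) y≤z))
            (λ (Fy⊆Fz : F y ⊆ F z) → subst₂ _≤_ (G∘F y xd≤y y≤x) (G∘F z xd≤z z≤x) (G-mono Fy⊆Fz))

        Ψ⊆canonical⇒Boolean : IntervalIsoBool L xd x ∣ X ∣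
        Ψ⊆canonical⇒Boolean = record
          { f = F ; g = G ; g-in = G-in ; g∘f = G∘F ; f∘g = F∘G ; f-order = F-order }

-- Only injectivity of j ↦ cg(j) on L itself is needed.
proposition5p1 : (L : FiniteLattice) → CongruenceUniform L →
    (x xd : FiniteLattice.Carrier L) → IsNucleus L x xd →
    (X : Subset (FiniteLattice.n L)) → IsCanonicalJoinRep L x X →
    ((∀ j → (j ∈ X) ⇔ InΨ L x xd j) ⇔ IntervalIsoBool L xd x ∣ X ∣)
proposition5p1 L ((_ , cgJ-injective , _) , _) x xd nucleus X canonical = mk⇔
  (λ X⇔Ψ → Ψ⊆canonical⇒Boolean L nucleus canonical (λ {j} → Equivalence.from (X⇔Ψ j)))
  (λ iso j → mk⇔ (canonical⊆Ψ L nucleus canonical)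
                 (Boolean⇒Ψ⊆canonical L nucleus canonical cgJ-injective iso))
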